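{- The edge set of the complete graph $K_{16}$ can be partitioned into five subgraphs each isomorphic to $P_4 \square P_4$.
   Context: $P_n$ denotes the path graph on $n$ vertices. For graphs $G=(V,E)$ and $G'=(V',E')$, the Cartesian product $G \square G'$ has vertex set $V \times V'$, with $(v,v')$ and $(w,w')$ adjacent iff either $\{v,w\}\in E$ and $v'=w'$, or $v=w$ and $\{v',w'\}\in E'$. A partition of $K_m$ into subgraphs means a collection of subgraphs of $K_m$ whose edge sets are pairwise disjoint and together cover all edges of $K_m$. -}

module Defs where

open import Data.Nat using (ℕ; suc)
open import Data.Fin using (Fin; toℕ)
open import Data.Product using (_×_; _,_; Σ; ∃; proj₁; proj₂)
open import Data.Sum using (_⊎_)
open import Relation.Binary.PropositionalEquality using (_≡_)
open import Relation.Nullary using (¬_)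
open import Function.Definitions using (Injective)

PathAdj : (n : ℕ) → Fin n → Fin n → Set
PathAdj n i j = suc (toℕ i) ≡ toℕ j ⊎ suc (toℕ j) ≡ toℕ i

GridAdj : (m n : ℕ) → Fin m × Fin n → Fin m × Fin n → Set
GridAdj m n (a , b) (c , d) =
  (PathAdj m a c × b ≡ d) ⊎ (a ≡ c × PathAdj n b d)

SamePair : {A : Set} → A → A → A → A → Set
SamePair x y u v = (x ≡ u × y ≡ v) ⊎ (x ≡ v × y ≡ u)

-- A copy of P_4 □ P_4 inside K_16: an injective vertex map; the subgraph
-- consists of the images of the edges of P_4 □ P_4.
record GridCopy : Set where
  field
    emb : Fin 4 × Fin 4 → Fin 16
    emb-inj : Injective _≡_ _≡_ emb
open GridCopy public

Covers : {k : ℕ} → (Fin k → GridCopy) → Fin k → Fin 4 × Fin 4 → Fin 4 × Fin 4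
       → Fin 16 → Fin 16 → Set
Covers G i a b u v = GridAdj 4 4 a b × SamePair (emb (G i) a) (emb (G i) b) u v

IsEdgePartitionK16 : {k : ℕ} → (Fin k → GridCopy) → Set
IsEdgePartitionK16 {k} G =
  ((u v : Fin 16) → ¬ u ≡ v →
     Σ (Fin k) λ i → Σ (Fin 4 × Fin 4) λ a → Σ (Fin 4 × Fin 4) λ b → Covers G i a b u v)
  × ((u v : Fin 16) (i j : Fin k) (a b c d : Fin 4 × Fin 4) →
       Covers G i a b u v → Covers G j c d u v → i ≡ j × SamePair a b c d)

-- Label the vertices of K₁₆ by ∞ and ℤ₁₅.  The translation x ↦ x + 3 fixes ∞ and
-- has order 5; it acts freely on the 120 edges, with 24 orbits.  A single copy of
-- P₄ □ P₄ whose 24 edges meet every orbit exactly once therefore yields a partition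
-- of K₁₆ by its five translates.
{-# OPTIONS --safe #-}
module Submission where

open import Defs
open import Data.Fin using (Fin; zero; suc; toℕ; #_) renaming (_≟_ to _≟ᶠ_)
open import Data.Fin.Properties using (all?; any?)
open import Data.Nat using (ℕ; _+_; _*_) renaming (_≟_ to _≟ⁿ_)
open import Data.Nat.DivMod using (_mod_)
open import Data.Product using (Σ; ∃; _×_; _,_; proj₂)
open import Data.Product.Properties using (≡-dec)
open import Data.Sum using (inj₁; inj₂) renaming (swap to ⊎-swap)
open import Data.Vec using (Vec; []; _∷_; lookup)
open import Function.Consequences.Propositional
  using (inverseʳ⇒injective; strictlyInverseʳ⇒inverseʳ)
open import Function.Definitions using (Injective)
open import Relation.Binary.PropositionalEquality using (_≡_; _≢_; refl)
open import Relation.Nullary.Decidable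
  using (Dec; from-yes; ¬?; _×-dec_; _⊎-dec_; _→-dec_)

pathAdj? : (n : ℕ) (i j : Fin n) → Dec (PathAdj n i j)
pathAdj? n i j = (ℕ.suc (toℕ i) ≟ⁿ toℕ j) ⊎-dec (ℕ.suc (toℕ j) ≟ⁿ toℕ i)

gridAdj? : (m n : ℕ) (x y : Fin m × Fin n) → Dec (GridAdj m n x y)
gridAdj? m n (a , b) (c , d) =
  (pathAdj? m a c ×-dec (b ≟ᶠ d)) ⊎-dec ((a ≟ᶠ c) ×-dec pathAdj? n b d)

PathAdj-sym : ∀ {n} {i j : Fin n} → PathAdj n i j → PathAdj n j i
PathAdj-sym = ⊎-swap

GridAdj-sym : ∀ {m n} {x y : Fin m × Fin n} → GridAdj m n x y → GridAdj m n y x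
GridAdj-sym (inj₁ (i~j , refl)) = inj₁ (PathAdj-sym i~j , refl)
GridAdj-sym (inj₂ (refl , i~j)) = inj₂ (refl , PathAdj-sym i~j)

SamePair-sym : ∀ {A : Set} {a b c d : A} → SamePair a b c d → SamePair c d a b
SamePair-sym (inj₁ (refl , refl)) = inj₁ (refl , refl)
SamePair-sym (inj₂ (refl , refl)) = inj₂ (refl , refl)

SamePair-trans : ∀ {A : Set} {a b c d e f : A} →
                 SamePair a b c d → SamePair c d e f → SamePair a b e f
SamePair-trans (inj₁ (refl , refl)) q = q
SamePair-trans (inj₂ (refl , refl)) (inj₁ (refl , refl)) = inj₂ (refl , refl)
SamePair-trans (inj₂ (refl , refl)) (inj₂ (refl , refl)) = inj₁ (refl , refl)

SamePair-injective : ∀ {A B : Set} {f : A → B} → Injective _≡_ _≡_ f →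
                     ∀ {a b c d} → SamePair (f a) (f b) (f c) (f d) → SamePair a b c d
SamePair-injective inj (inj₁ (p , q)) = inj₁ (inj p , inj q)
SamePair-injective inj (inj₂ (p , q)) = inj₂ (inj p , inj q)

-- For copies spanning all 16 vertices, whether an edge lies in a copy is decided
-- through the inverse vertex map.
module SpanningCopies {k : ℕ} (G : Fin k → GridCopy)
                      (position : Fin k → Fin 16 → Fin 4 × Fin 4)
                      (emb-position : ∀ i u → emb (G i) (position i u) ≡ u) where

  AdjacentIn : Fin k → Fin 16 → Fin 16 → Set
  AdjacentIn i u v = GridAdj 4 4 (position i u) (position i v)

  position-emb : ∀ i a → position i (emb (G i) a) ≡ a
  position-emb i a = emb-inj (G i) (emb-position i (emb (G i) a))

  covers⇒adjacentIn : ∀ {i a b u v} → Covers G i a b u v → AdjacentIn i u v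
  covers⇒adjacentIn {i} {a} {b} (a~b , inj₁ (refl , refl))
    rewrite position-emb i a | position-emb i b = a~b
  covers⇒adjacentIn {i} {a} {b} (a~b , inj₂ (refl , refl))
    rewrite position-emb i a | position-emb i b = GridAdj-sym a~b

  adjacentIn⇒covers : ∀ {i u v} → AdjacentIn i u v →
                      Covers G i (position i u) (position i v) u v
  adjacentIn⇒covers {i} {u} {v} u~v = u~v , inj₁ (emb-position i u , emb-position i v)

  isEdgePartition : (∀ u v → u ≢ v → ∃ λ i → AdjacentIn i u v) →
                    (∀ i j u v → AdjacentIn i u v → AdjacentIn j u v → i ≡ j) →
                    IsEdgePartitionK16 G
  isEdgePartition covering unique = cover , disjoint
    where
    cover : ∀ u v → u ≢ v → Σ (Fin k) λ i → Σ (Fin 4 × Fin 4) λ a →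
            Σ (Fin 4 × Fin 4) λ b → Covers G i a b u v
    cover u v u≢v with covering u v u≢v
    ... | i , u~v = i , position i u , position i v , adjacentIn⇒covers u~v

    disjoint : ∀ u v i j a b c d →
               Covers G i a b u v → Covers G j c d u v → i ≡ j × SamePair a b c d
    disjoint u v i j a b c d ci cj
      with unique i j u v (covers⇒adjacentIn ci) (covers⇒adjacentIn cj)
    ... | refl = refl , SamePair-injective (emb-inj (G i))
                          (SamePair-trans (proj₂ ci) (SamePair-sym (proj₂ cj)))

-- Vertex zero is ∞ and suc x is x ∈ ℤ₁₅.
translate : ℕ → Fin 16 → Fin 16
translate d zero = zero
translate d (suc x) = suc ((toℕ x + d) mod 15)

baseGrid : Vec (Vec (Fin 16) 4) 4
baseGrid = (# 1  ∷ # 0  ∷ # 2  ∷ # 4  ∷ [])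
         ∷ (# 11 ∷ # 3  ∷ # 13 ∷ # 10 ∷ [])
         ∷ (# 8  ∷ # 7  ∷ # 15 ∷ # 9  ∷ [])
         ∷ (# 12 ∷ # 14 ∷ # 5  ∷ # 6  ∷ [])
         ∷ []

basePosition : Vec (Fin 4 × Fin 4) 16
basePosition = (# 0 , # 1) ∷ (# 0 , # 0) ∷ (# 0 , # 2) ∷ (# 1 , # 1)
             ∷ (# 0 , # 3) ∷ (# 3 , # 2) ∷ (# 3 , # 3) ∷ (# 2 , # 1)
             ∷ (# 2 , # 0) ∷ (# 2 , # 3) ∷ (# 1 , # 3) ∷ (# 1 , # 0)
             ∷ (# 3 , # 0) ∷ (# 1 , # 2) ∷ (# 3 , # 1) ∷ (# 2 , # 2)
             ∷ []

translatedEmb : Fin 5 → Fin 4 × Fin 4 → Fin 16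
translatedEmb i (r , c) = translate (3 * toℕ i) (lookup (lookup baseGrid r) c)

-- translate (12 i) undoes translate (3 i), as 15 i ≡ 0 (mod 15).
position : Fin 5 → Fin 16 → Fin 4 × Fin 4
position i u = lookup basePosition (translate (12 * toℕ i) u)

_≟ᵍ_ : (x y : Fin 4 × Fin 4) → Dec (x ≡ y)
_≟ᵍ_ = ≡-dec _≟ᶠ_ _≟ᶠ_

position-translatedEmb : ∀ i x → position i (translatedEmb i x) ≡ x
position-translatedEmb i (r , c) =
  from-yes (all? λ i → all? λ r → all? λ c →
              position i (translatedEmb i (r , c)) ≟ᵍ (r , c)) i r c

translatedEmb-position : ∀ i u → translatedEmb i (position i u) ≡ u
translatedEmb-position =
  from-yes (all? λ i → all? λ u → translatedEmb i (position i u) ≟ᶠ u)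

translatedCopy : Fin 5 → GridCopy
translatedCopy i = record
  { emb = translatedEmb i
  ; emb-inj = inverseʳ⇒injective (translatedEmb i)
                (strictlyInverseʳ⇒inverseʳ {f⁻¹ = position i} (translatedEmb i)
                   (position-translatedEmb i))
  }

open SpanningCopies translatedCopy position translatedEmb-position

adjacentIn? : ∀ i u v → Dec (AdjacentIn i u v)
adjacentIn? i u v = gridAdj? 4 4 (position i u) (position i v)

every-edge-adjacentIn : ∀ u v → u ≢ v → ∃ λ i → AdjacentIn i u v
every-edge-adjacentIn =
  from-yes (all? λ u → all? λ v → ¬? (u ≟ᶠ v) →-dec any? λ i → adjacentIn? i u v)

adjacentIn-unique : ∀ i j u v → AdjacentIn i u v → AdjacentIn j u v → i ≡ j
adjacentIn-unique =
  from-yes (all? λ i → all? λ j → all? λ u → all? λ v →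
              adjacentIn? i u v →-dec (adjacentIn? j u v →-dec (i ≟ᶠ j)))

theorem4 : Σ (Fin 5 → GridCopy) IsEdgePartitionK16
theorem4 = translatedCopy , isEdgePartition every-edge-adjacentIn adjacentIn-unique
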